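{- For every finite digraph $D$, $0 \leq \kappa(D) \leq cic(D)$, where $cic(D)$ denotes the number of directed cycles of $D$ without chords.
   Context: A kernel of a digraph $D$ is a set $N\subseteq V(D)$ that is independent (no arc between two vertices of $N$) and absorbent (for every $u\in V(D)\setminus N$ there is $v\in N$ with $(u,v)\in A(D)$). Subdividing an arc $(u,v)$ means replacing it by a new vertex $a$ and the arcs $(u,a),(a,v)$. For $\Lambda\subseteq A(D)$, $D_\Lambda$ is the digraph obtained from $D$ by subdividing every arc of $\Lambda$. The kernel subdivision number $\kappa(D)$ is the smallest cardinality of a set $\Lambda\subseteq A(D)$ such that $D_\Lambda$ has a kernel. A chord of a directed cycle $C$ is an arc of $D$ joining two vertices of $C$ that is not an arc of $C$. -}

module Defs where

open import Data.Nat using (ℕ; zero; suc; _≤_; _<?_)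
open import Data.Fin using (Fin; zero; suc; toℕ; fromℕ<)
open import Data.Bool using (Bool; true; false; if_then_else_)
open import Data.Product using (Σ; ∃; _×_; _,_; proj₁; proj₂)
open import Data.Sum using (_⊎_; inj₁; inj₂)
open import Data.Empty using (⊥)
open import Data.List using (List; length)
open import Data.List.Relation.Unary.All using (All)
open import Data.List.Relation.Unary.AllPairs using (AllPairs)
open import Data.List.Membership.Propositional using (_∈_)
open import Relation.Nullary using (¬_; yes; no)
open import Relation.Binary.PropositionalEquality using (_≡_)
open import Function.Definitions using (Injective)

record Digraph : Set where
  field
    n        : ℕ
    arc      : Fin n → Fin n → Bool
    loopless : ∀ u → arc u u ≡ false
open Digraph public

ArcSet : ℕ → Set
ArcSet n = Fin n → Fin n → Bool

_⊆A_ : (D : Digraph) → ArcSet (n D) → Set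
D ⊆A Λ = ∀ u v → Λ u v ≡ true → arc D u v ≡ true

sumFin : ∀ {m} → (Fin m → ℕ) → ℕ
sumFin {zero}  f = 0
sumFin {suc m} f = f zero Data.Nat.+ sumFin (λ i → f (suc i))

card : ∀ {m} → ArcSet m → ℕ
card Λ = sumFin (λ u → sumFin (λ v → if Λ u v then 1 else 0))

record IsKernel {V : Set} (Arc : V → V → Set) (N : V → Bool) : Set where
  field
    independent : ∀ x y → N x ≡ true → N y ≡ true → ¬ Arc x y
    absorbent   : ∀ x → N x ≡ false → Σ V (λ y → N y ≡ true × Arc x y)

HasKernel : {V : Set} → (V → V → Set) → Set
HasKernel {V} Arc = Σ (V → Bool) (IsKernel Arc)

-- The subdivided digraph D_Λ.  Vertices: old vertices, plus one new
-- vertex for every arc (a , b) ∈ Λ.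

SubVertex : (D : Digraph) → ArcSet (n D) → Set
SubVertex D Λ = Fin (n D) ⊎ Σ (Fin (n D) × Fin (n D)) (λ p → Λ (proj₁ p) (proj₂ p) ≡ true)

SubArc : (D : Digraph) (Λ : ArcSet (n D)) → SubVertex D Λ → SubVertex D Λ → Set
SubArc D Λ (inj₁ u) (inj₁ v) = arc D u v ≡ true × Λ u v ≡ false
SubArc D Λ (inj₁ u) (inj₂ ((a , b) , _)) = u ≡ a
SubArc D Λ (inj₂ ((a , b) , _)) (inj₁ v) = b ≡ v
SubArc D Λ (inj₂ _) (inj₂ _) = ⊥

SubdivisionHasKernel : (D : Digraph) → ArcSet (n D) → Set
SubdivisionHasKernel D Λ = HasKernel (SubArc D Λ)

IsKappa : Digraph → ℕ → Set
IsKappa D k =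
  Σ (ArcSet (n D)) (λ Λ → D ⊆A Λ × SubdivisionHasKernel D Λ × card Λ ≡ k)
  × (∀ Λ → D ⊆A Λ → SubdivisionHasKernel D Λ → k ≤ card Λ)

next : ∀ {k} → Fin (suc k) → Fin (suc k)
next {k} i with suc (toℕ i) <? suc k
... | yes p = fromℕ< p
... | no _  = zero

-- A directed cycle is given by an
-- injective cyclic sequence f 0 → f 1 → … → f k → f 0 of vertices; the
-- cycle (as a subdigraph) is identified with its arc set C.
IsChordlessCycle : (D : Digraph) → ArcSet (n D) → Set
IsChordlessCycle D C =
  Σ ℕ λ k → Σ (Fin (suc k) → Fin (n D)) λ f →
    1 ≤ k
    × Injective _≡_ _≡_ f
    × (∀ i → arc D (f i) (f (next i)) ≡ true)
    × (∀ u v → C u v ≡ true → Σ (Fin (suc k)) λ i → f i ≡ u × f (next i) ≡ v)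
    × (∀ i → C (f i) (f (next i)) ≡ true)
    -- no chords: every arc of D between vertices of the cycle is in C
    × (∀ i j → arc D (f i) (f j) ≡ true → C (f i) (f j) ≡ true)

_≐_ : ∀ {m} → ArcSet m → ArcSet m → Set
C ≐ C' = ∀ u v → C u v ≡ C' u v

IsCic : Digraph → ℕ → Set
IsCic D c =
  Σ (List (ArcSet (n D))) λ L →
    All (IsChordlessCycle D) L
    × AllPairs (λ C C' → ¬ (C ≐ C')) L
    × (∀ C → IsChordlessCycle D C → Σ (ArcSet (n D)) λ C' → C' ∈ L × C ≐ C')
    × length L ≡ c

-- By induction on a vertex set R we build S ⊆ R and a set Λ of arcs with tail in R such
-- that S, together with the subdivision vertices of the arcs of Λ whose head is not in S,
-- is independent in D_Λ and absorbs every vertex of R; for R = V(D) this is a kernel.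
-- If D[R] has a sink x, solve for R minus x and its in-neighbours and add x to S: it
-- absorbs the removed vertices, and nothing is subdivided.  Otherwise shortening a closed
-- walk of D[R] as long as possible yields a chordless cycle C of D[R]; pick an arc xy of
-- C and solve for R − x.  If y ∈ S it absorbs x; otherwise subdivide xy, whose new vertex
-- joins the kernel and absorbs x.  Each subdivision is paid for by its cycle C, and these
-- cycles are pairwise distinct because C passes through x while those used for R − x do
-- not.  Finally κ(D) exists because arc sets and kernels can be searched exhaustively.

module Submission where

open import Defs
open import Data.Bool using (Bool; true; false; not; _∧_; _∨_; if_then_else_)
open import Data.Bool.Properties using (¬-not) renaming (_≟_ to _≟ᵇ_)
open import Data.Empty using (⊥; ⊥-elim)
open import Data.Fin using (Fin; zero; suc; toℕ) renaming (_≟_ to _≟ᶠ_)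
open import Data.Fin.Properties
  using (all?; any?; suc-injective; toℕ-injective; toℕ≤pred[n]; toℕ-fromℕ<; pigeonhole; <-cmp)
open import Data.List using (List; []; _∷_; length)
open import Data.List.Membership.Propositional using (_∈_)
open import Data.List.Relation.Unary.All using (All; []; _∷_)
import Data.List.Relation.Unary.All as All
open import Data.List.Relation.Unary.AllPairs using (AllPairs; []; _∷_)
open import Data.List.Relation.Unary.Any using (here; there)
open import Data.Nat using (ℕ; zero; suc; _+_; _≤_; _<_; z≤n; s≤s; z<s; _<?_; _%_)
open import Data.Nat.DivMod using (m%n<n; m<n⇒m%n≡m; n%n≡0; [m+n]%n≡m%n; %-distribˡ-+; m%n%n≡m%n)
open import Data.Nat.Induction using (<-wellFounded)
open import Data.Nat.Properties
  using (_≤?_; ≤-refl; ≤-reflexive; ≤-trans; ≤-pred; ≤-antisym; <-≤-trans; ≤-<-trans; ≮⇒≥; ≰⇒>;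
         m≤n⇒m≤1+n; m≤n⇒m<n∨m≡n; ≤∧≢⇒<; <-irrefl; m≤n+m; m<n+m; n≤1+n; n<1+n; +-suc; +-identityʳ;
         +-mono-≤; +-mono-<-≤; +-mono-≤-<; +-monoˡ-≤; +-cancelˡ-≤; m≤n⇒∃[o]m+o≡n; module ≤-Reasoning)
  renaming (_≟_ to _≟ℕ_)
open import Data.Product using (Σ; ∃; ∃₂; _×_; _,_; proj₁; proj₂)
open import Data.Sum using (_⊎_; inj₁; inj₂; [_,_]; map₂)
open import Function using (_∘_)
open import Induction.WellFounded using (Acc; acc)
open import Level using (Level; 0ℓ)
open import Relation.Binary.Bundles using (Setoid)
open import Relation.Binary.Definitions using (_Respects_; tri<; tri≈; tri>)
open import Relation.Binary.PropositionalEquality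
  using (_≡_; _≢_; _≗_; refl; sym; trans; cong; cong₂; subst; module ≡-Reasoning)
open import Relation.Nullary using (¬_; Dec; yes; no; does; contradiction)
open import Relation.Nullary.Decidable using (map′; dec-true; dec-false; _×-dec_; _⊎-dec_; _→-dec_; ¬?)
open import Relation.Unary using (Decidable)

bool-clash : ∀ {b} → b ≡ true → b ≡ false → ⊥
bool-clash refl ()

does⇒ : ∀ {A : Set} (a? : Dec A) → does a? ≡ true → A
does⇒ (yes a) _ = a

-- Exhaustive search

-- Without function extensionality, a function space can only be searched for predicates
-- that respect pointwise equality.
Searchable : (A : Set) → (A → A → Set) → Set₁
Searchable A _≈_ = ∀ (P : A → Set) → P Respects _≈_ → Decidable P → Dec (∃ P)

searchable-Bool : Searchable Bool _≡_
searchable-Bool P _ P? with P? true | P? false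
... | yes p | _     = yes (true , p)
... | no _  | yes p = yes (false , p)
... | no ¬t | no ¬f = no λ { (true , p) → ¬t p ; (false , p) → ¬f p }

_∷ᶠ_ : ∀ {A : Set} {m} → A → (Fin m → A) → Fin (suc m) → A
(a ∷ᶠ f) zero    = a
(a ∷ᶠ f) (suc i) = f i

searchable-Fin→ : ∀ {A : Set} {_≈_ : A → A → Set} → (∀ {a} → a ≈ a) → Searchable A _≈_ →
  ∀ m → Searchable (Fin m → A) (λ f g → ∀ i → f i ≈ g i)
searchable-Fin→ _ _ zero P resp P? with P? (λ ())
... | yes p = yes (_ , p)
... | no ¬p = no λ (f , p) → ¬p (resp (λ ()) p)
searchable-Fin→ {A} {_≈_} ≈-refl search-A (suc m) P resp P? = by-head (search-A Head resp-Head Head?)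
  where
  Head : A → Set
  Head a = ∃ λ f → P (a ∷ᶠ f)
  resp-Head : Head Respects _≈_
  resp-Head a≈b (f , p) = f , resp (λ { zero → a≈b ; (suc i) → ≈-refl }) p
  Head? : Decidable Head
  Head? a = searchable-Fin→ ≈-refl search-A m (λ f → P (a ∷ᶠ f))
    (λ f≈g → resp λ { zero → ≈-refl ; (suc i) → f≈g i }) (λ f → P? (a ∷ᶠ f))
  by-head : Dec (∃ Head) → Dec (∃ P)
  by-head (yes (a , f , p)) = yes (a ∷ᶠ f , p)
  by-head (no ¬head)        = no λ (f , p) →
    ¬head (f zero , (λ i → f (suc i)) , resp (λ { zero → ≈-refl ; (suc i) → ≈-refl }) p)

searchable-Subset : ∀ m → Searchable (Fin m → Bool) _≗_
searchable-Subset = searchable-Fin→ refl searchable-Bool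

searchable-ArcSet : ∀ m → Searchable (ArcSet m) (λ Λ Λ′ → ∀ u → Λ u ≗ Λ′ u)
searchable-ArcSet m = searchable-Fin→ (λ _ → refl) (searchable-Subset m) m

least-or-none : ∀ {P : ℕ → Set} → Decidable P → ∀ m →
  (∃ λ k → P k × k ≤ m × (∀ j → j < k → ¬ P j)) ⊎ (∀ j → j ≤ m → ¬ P j)
least-or-none P? zero with P? zero
... | yes p = inj₁ (zero , p , z≤n , λ _ ())
... | no ¬p = inj₂ λ { zero z≤n → ¬p }
least-or-none P? (suc m) with least-or-none P? m
... | inj₁ (k , p , k≤m , below) = inj₁ (k , p , m≤n⇒m≤1+n k≤m , below)
... | inj₂ none with P? (suc m)
...   | yes p = inj₁ (suc m , p , ≤-refl , λ j j<1+m → none j (≤-pred j<1+m))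
...   | no ¬p = inj₂ λ j j≤1+m → [ (λ j<1+m → none j (≤-pred j<1+m)) , (λ { refl → ¬p }) ]
                                      (m≤n⇒m<n∨m≡n j≤1+m)

least : ∀ {P : ℕ → Set} → Decidable P → ∀ {m} → P m → ∃ λ k → P k × k ≤ m × (∀ j → j < k → ¬ P j)
least P? {m} p with least-or-none P? m
... | inj₁ found = found
... | inj₂ none  = ⊥-elim (none m ≤-refl p)

indicator : Bool → ℕ
indicator b = if b then 1 else 0

indicator-mono : ∀ {a b} → (a ≡ true → b ≡ true) → indicator a ≤ indicator b
indicator-mono {false} _   = z≤n
indicator-mono {true}  a⇒b rewrite a⇒b refl = ≤-refl

indicator-< : ∀ {a b} → a ≡ false → b ≡ true → indicator a < indicator b
indicator-< refl refl = s≤s z≤n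

count : ∀ {m} → (Fin m → Bool) → ℕ
count R = sumFin (indicator ∘ R)

sumFin-cong : ∀ {m} {f g : Fin m → ℕ} → f ≗ g → sumFin f ≡ sumFin g
sumFin-cong {zero}  _   = refl
sumFin-cong {suc m} f≗g = cong₂ _+_ (f≗g zero) (sumFin-cong (λ i → f≗g (suc i)))

sumFin-mono : ∀ {m} {f g : Fin m → ℕ} → (∀ i → f i ≤ g i) → sumFin f ≤ sumFin g
sumFin-mono {zero}  _   = z≤n
sumFin-mono {suc m} f≤g = +-mono-≤ (f≤g zero) (sumFin-mono (λ i → f≤g (suc i)))

sumFin-mono-< : ∀ {m} {f g : Fin m → ℕ} (x : Fin m) → (∀ i → f i ≤ g i) → f x < g x → sumFin f < sumFin g
sumFin-mono-< zero    f≤g fx<gx = +-mono-<-≤ fx<gx (sumFin-mono (λ i → f≤g (suc i)))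
sumFin-mono-< (suc x) f≤g fx<gx = +-mono-≤-< (f≤g zero) (sumFin-mono-< x (λ i → f≤g (suc i)) fx<gx)

sumFin-≤-suc : ∀ {m} {f g : Fin m → ℕ} (x : Fin m) → (∀ i → i ≢ x → f i ≤ g i) → f x ≤ suc (g x) →
  sumFin f ≤ suc (sumFin g)
sumFin-≤-suc zero    f≤g fx≤ = +-mono-≤ fx≤ (sumFin-mono (λ i → f≤g (suc i) λ ()))
sumFin-≤-suc {suc m} {f} {g} (suc x) f≤g fx≤ = begin
  f zero + sumFin (λ i → f (suc i))       ≤⟨ +-mono-≤ (f≤g zero λ ()) (sumFin-≤-suc x f≤g-tail fx≤) ⟩
  g zero + suc (sumFin (λ i → g (suc i))) ≡⟨ +-suc (g zero) _ ⟩
  suc (sumFin g)                          ∎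
  where
  open ≤-Reasoning
  f≤g-tail : ∀ i → i ≢ x → f (suc i) ≤ g (suc i)
  f≤g-tail i i≢x = f≤g (suc i) (i≢x ∘ suc-injective)

sumFin-zero : ∀ {m} → sumFin {m} (λ _ → 0) ≡ 0
sumFin-zero {zero}  = refl
sumFin-zero {suc m} = sumFin-zero {m}

card-cong : ∀ {m} {Λ Λ′ : ArcSet m} → (∀ u → Λ u ≗ Λ′ u) → card Λ ≡ card Λ′
card-cong Λ≗ = sumFin-cong λ u → sumFin-cong λ v → cong indicator (Λ≗ u v)

module _ {m : ℕ} where

  private
    V : Set
    V = Fin m

  remove : {P : V → Set} → Decidable P → (V → Bool) → V → Bool
  remove P? R u = R u ∧ not (does (P? u))

  module Remove {P : V → Set} (P? : Decidable P) (R : V → Bool) where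

    remove-⊆ : ∀ {u} → remove P? R u ≡ true → R u ≡ true
    remove-⊆ {u} kept with R u
    ... | true = refl

    remove-∉ : ∀ {u} → remove P? R u ≡ true → ¬ P u
    remove-∉ {u} kept with R u | P? u
    ... | true | no ¬Pu = ¬Pu

    remove-∋ : ∀ {u} → R u ≡ true → ¬ P u → remove P? R u ≡ true
    remove-∋ {u} Ru ¬Pu rewrite Ru | dec-false (P? u) ¬Pu = refl

    remove-removed : ∀ {u} → P u → remove P? R u ≡ false
    remove-removed Pu = ¬-not λ kept → remove-∉ kept Pu

    count-remove : ∀ {x} → R x ≡ true → P x → count (remove P? R) < count R
    count-remove {x} Rx Px =
      sumFin-mono-< x (λ u → indicator-mono (remove-⊆ {u})) (indicator-< (remove-removed Px) Rx)

  insert : V → (V → Bool) → V → Bool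
  insert x S u = does (u ≟ᶠ x) ∨ S u

  module Insert (x : V) (S : V → Bool) where

    insert-new : insert x S x ≡ true
    insert-new rewrite dec-true (x ≟ᶠ x) refl = refl

    insert-old : ∀ {u} → S u ≡ true → insert x S u ≡ true
    insert-old {u} Su with does (u ≟ᶠ x)
    ... | true  = refl
    ... | false = Su

    insert-other : ∀ {u} → u ≢ x → insert x S u ≡ S u
    insert-other {u} u≢x rewrite dec-false (u ≟ᶠ x) u≢x = refl

    insert-elim : ∀ {u} → insert x S u ≡ true → u ≡ x ⊎ S u ≡ true
    insert-elim {u} inserted with u ≟ᶠ x
    ... | yes u≡x = inj₁ u≡x
    ... | no  _   = inj₂ inserted

    count-insert : count (insert x S) ≤ suc (count S)
    count-insert = sumFin-≤-suc x (λ _ u≢x → ≤-reflexive (cong indicator (insert-other u≢x)))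
                                  (subst (λ b → indicator b ≤ suc (indicator (S x))) (sym insert-new) (s≤s z≤n))

  insertArc : V → V → ArcSet m → ArcSet m
  insertArc x y Λ u = if does (u ≟ᶠ x) then insert y (Λ u) else Λ u

  module InsertArc (x y : V) (Λ : ArcSet m) where
    open Insert y

    insertArc-new : insertArc x y Λ x y ≡ true
    insertArc-new rewrite dec-true (x ≟ᶠ x) refl = insert-new (Λ x)

    insertArc-old : ∀ {u v} → Λ u v ≡ true → insertArc x y Λ u v ≡ true
    insertArc-old {u} Λuv with does (u ≟ᶠ x)
    ... | true  = insert-old (Λ u) Λuv
    ... | false = Λuv

    insertArc-other : ∀ {u} → u ≢ x → insertArc x y Λ u ≗ Λ u
    insertArc-other {u} u≢x v rewrite dec-false (u ≟ᶠ x) u≢x = refl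

    insertArc-elim : ∀ {u v} → insertArc x y Λ u v ≡ true → (u ≡ x × v ≡ y) ⊎ Λ u v ≡ true
    insertArc-elim {u} inserted with u ≟ᶠ x
    ... | no  _    = inj₂ inserted
    ... | yes refl with insert-elim (Λ u) inserted
    ...   | inj₁ v≡y = inj₁ (refl , v≡y)
    ...   | inj₂ Λuv = inj₂ Λuv

    card-insertArc : card (insertArc x y Λ) ≤ suc (card Λ)
    card-insertArc = sumFin-≤-suc x other-row row-x
      where
      other-row : ∀ u → u ≢ x → count (insertArc x y Λ u) ≤ count (Λ u)
      other-row _ u≢x = ≤-reflexive (sumFin-cong (cong indicator ∘ insertArc-other u≢x))
      row-x : count (insertArc x y Λ x) ≤ suc (count (Λ x))
      row-x rewrite dec-true (x ≟ᶠ x) refl = count-insert (Λ x)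

∈-remove : ∀ {A : Set} {x : A} (ys : List A) → x ∈ ys →
  ∃ λ zs → length ys ≡ suc (length zs) × (∀ {y} → y ∈ ys → y ≡ x ⊎ y ∈ zs)
∈-remove (y ∷ ys) (here refl) = ys , refl , λ { (here refl) → inj₁ refl ; (there y∈ys) → inj₂ y∈ys }
∈-remove (y ∷ ys) (there x∈ys) with ∈-remove ys x∈ys
... | zs , len , split =
  y ∷ zs , cong suc len , λ { (here refl) → inj₂ (here refl) ; (there w∈ys) → map₂ there (split w∈ys) }

module _ {ℓ : Level} (S : Setoid 0ℓ ℓ) where
  open Setoid S using (_≈_) renaming (Carrier to A; sym to ≈-sym; trans to ≈-trans)
  open import Data.List.Relation.Unary.Unique.Setoid S using (Unique)

  Covered : List A → A → Set _
  Covered ys x = ∃ λ y → y ∈ ys × x ≈ y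

  length-≤-of-covered : ∀ xs ys → Unique xs → All (Covered ys) xs → length xs ≤ length ys
  length-≤-of-covered []       ys _                     _                            = z≤n
  length-≤-of-covered (x ∷ xs) ys (x≉xs ∷ unique) ((y , y∈ys , x≈y) ∷ covered) with ∈-remove ys y∈ys
  ... | zs , len , split =
    subst (suc (length xs) ≤_) (sym len) (s≤s (length-≤-of-covered xs zs unique (re-cover x≉xs covered)))
    where
    re-cover : ∀ {ws} → All (λ w → ¬ x ≈ w) ws → All (Covered ys) ws → All (Covered zs) ws
    re-cover []              []                              = []
    re-cover (x≉w ∷ x≉ws) ((v , v∈ys , w≈v) ∷ covered′) with split v∈ys
    ... | inj₁ refl = contradiction (≈-trans x≈y (≈-sym w≈v)) x≉w
    ... | inj₂ v∈zs = (v , v∈zs , w≈v) ∷ re-cover x≉ws covered′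

≐-setoid : ℕ → Setoid 0ℓ 0ℓ
≐-setoid m = record
  { Carrier = ArcSet m
  ; _≈_ = _≐_
  ; isEquivalence = record
    { refl  = λ _ _ → refl
    ; sym   = λ C≐C′ u v → sym (C≐C′ u v)
    ; trans = λ C≐C′ C′≐C″ u v → trans (C≐C′ u v) (C′≐C″ u v)
    }
  }

-- Kernels of subdivisions

module _ (D : Digraph) where

  private
    V : Set
    V = Fin (n D)

  -- A kernel of D_Λ is described by the set S of its original vertices: the subdivision
  -- vertex of an arc uv ∈ Λ must belong to it exactly when v ∉ S.
  Absorbed : ArcSet (n D) → (V → Bool) → V → Set
  Absorbed Λ S u =
    (Σ V λ v → S v ≡ true × arc D u v ≡ true × Λ u v ≡ false) ⊎ (Σ V λ v → Λ u v ≡ true × S v ≡ false)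

  record IsKernelTraceOn (Λ : ArcSet (n D)) (R S : V → Bool) : Set where
    field
      subdivided-inside : ∀ u v → S u ≡ true → S v ≡ true → arc D u v ≡ true → Λ u v ≡ true
      subdivided-out    : ∀ u v → Λ u v ≡ true → S u ≡ true → S v ≡ true
      absorbed          : ∀ u → R u ≡ true → S u ≡ false → Absorbed Λ S u

  IsKernelTrace : ArcSet (n D) → (V → Bool) → Set
  IsKernelTrace Λ = IsKernelTraceOn Λ (λ _ → true)

  trace⇒kernel : ∀ {Λ S} → IsKernelTrace Λ S → SubdivisionHasKernel D Λ
  trace⇒kernel {Λ} {S} t = N , record { independent = independent ; absorbent = absorbent }
    where
    open IsKernelTraceOn t
    N : SubVertex D Λ → Bool
    N (inj₁ u)               = S u
    N (inj₂ ((_ , v) , _)) = not (S v)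
    independent : ∀ x y → N x ≡ true → N y ≡ true → ¬ SubArc D Λ x y
    independent (inj₁ u) (inj₁ v) Su Sv (uv , ¬Λuv) = bool-clash (subdivided-inside u v Su Sv uv) ¬Λuv
    independent (inj₁ u) (inj₂ ((_ , v) , Λuv)) Su ¬Sv refl with S v in Sv
    ... | true  = bool-clash ¬Sv refl
    ... | false = bool-clash (subdivided-out u v Λuv Su) Sv
    independent (inj₂ ((_ , v) , _)) (inj₁ _) ¬Sv Sv refl with S v
    ... | true  = bool-clash ¬Sv refl
    ... | false = bool-clash Sv refl
    independent (inj₂ _) (inj₂ _) _ _ ()
    absorbent : ∀ x → N x ≡ false → Σ (SubVertex D Λ) λ y → N y ≡ true × SubArc D Λ x y
    absorbent (inj₁ u) ¬Su with absorbed u refl ¬Su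
    ... | inj₁ (v , Sv , uv , ¬Λuv) = inj₁ v , Sv , uv , ¬Λuv
    ... | inj₂ (v , Λuv , ¬Sv)      = inj₂ ((u , v) , Λuv) , cong not ¬Sv , refl
    absorbent (inj₂ ((_ , v) , _)) ¬¬Sv with S v in Sv
    ... | true  = inj₁ v , Sv , refl
    ... | false = ⊥-elim (bool-clash refl ¬¬Sv)

  kernel⇒trace : ∀ {Λ} → SubdivisionHasKernel D Λ → ∃ (IsKernelTrace Λ)
  kernel⇒trace {Λ} (N , record { independent = independent ; absorbent = absorbent }) =
    S , record { subdivided-inside = inside ; subdivided-out = out ; absorbed = absorbed }
    where
    S : V → Bool
    S u = N (inj₁ u)
    inside : ∀ u v → S u ≡ true → S v ≡ true → arc D u v ≡ true → Λ u v ≡ true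
    inside u v Su Sv uv with Λ u v in Λuv
    ... | true  = refl
    ... | false = ⊥-elim (independent (inj₁ u) (inj₁ v) Su Sv (uv , Λuv))
    out : ∀ u v → Λ u v ≡ true → S u ≡ true → S v ≡ true
    out u v Λuv Su with N (inj₂ ((u , v) , Λuv)) in Nuv
    ... | true  = ⊥-elim (independent (inj₁ u) (inj₂ ((u , v) , Λuv)) Su Nuv refl)
    ... | false with absorbent (inj₂ ((u , v) , Λuv)) Nuv
    ...   | inj₁ _ , Nw , refl = Nw
    absorbed : ∀ u → true ≡ true → S u ≡ false → Absorbed Λ S u
    absorbed u _ ¬Su with absorbent (inj₁ u) ¬Su
    ... | inj₁ v , Sv , uv , ¬Λuv = inj₁ (v , Sv , uv , ¬Λuv)
    ... | inj₂ ((_ , v) , Λuv) , Nuv , refl with N (inj₁ v) in Sv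
    ...   | true  = ⊥-elim (independent (inj₂ ((u , v) , Λuv)) (inj₁ v) Nuv Sv refl)
    ...   | false = inj₂ (v , Λuv , Sv)

  isKernelTraceOn? : ∀ Λ R S → Dec (IsKernelTraceOn Λ R S)
  isKernelTraceOn? Λ R S = map′
    (λ (i , o , a) → record { subdivided-inside = i ; subdivided-out = o ; absorbed = a })
    (λ t → let open IsKernelTraceOn t in subdivided-inside , subdivided-out , absorbed)
    (  all? (λ u → all? λ v → (S u ≟ᵇ true) →-dec (S v ≟ᵇ true) →-dec (arc D u v ≟ᵇ true) →-dec (Λ u v ≟ᵇ true))
    ×-dec all? (λ u → all? λ v → (Λ u v ≟ᵇ true) →-dec (S u ≟ᵇ true) →-dec (S v ≟ᵇ true))
    ×-dec all? (λ u → (R u ≟ᵇ true) →-dec (S u ≟ᵇ false) →-dec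
            (  any? (λ v → (S v ≟ᵇ true) ×-dec (arc D u v ≟ᵇ true) ×-dec (Λ u v ≟ᵇ false))
            ⊎-dec any? (λ v → (Λ u v ≟ᵇ true) ×-dec (S v ≟ᵇ false)))))

  IsKernelTraceOn-cong : ∀ {Λ Λ′ R S S′} → (∀ u → Λ u ≗ Λ′ u) → S ≗ S′ →
    IsKernelTraceOn Λ R S → IsKernelTraceOn Λ′ R S′
  IsKernelTraceOn-cong {Λ} {Λ′} {R} {S} {S′} Λ≗ S≗ t = record
    { subdivided-inside = λ u v Su Sv uv → ≡Λ u v (subdivided-inside u v (≡S⁻ u Su) (≡S⁻ v Sv) uv)
    ; subdivided-out    = λ u v Λuv Su → ≡S v (subdivided-out u v (≡Λ⁻ u v Λuv) (≡S⁻ u Su))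
    ; absorbed          = absorbed′
    }
    where
    open IsKernelTraceOn t
    ≡S : ∀ {b} u → S u ≡ b → S′ u ≡ b
    ≡S u = trans (sym (S≗ u))
    ≡S⁻ : ∀ {b} u → S′ u ≡ b → S u ≡ b
    ≡S⁻ u = trans (S≗ u)
    ≡Λ : ∀ {b} u v → Λ u v ≡ b → Λ′ u v ≡ b
    ≡Λ u v = trans (sym (Λ≗ u v))
    ≡Λ⁻ : ∀ {b} u v → Λ′ u v ≡ b → Λ u v ≡ b
    ≡Λ⁻ u v = trans (Λ≗ u v)
    absorbed′ : ∀ u → R u ≡ true → S′ u ≡ false → Absorbed Λ′ S′ u
    absorbed′ u Ru ¬Su with absorbed u Ru (≡S⁻ u ¬Su)
    ... | inj₁ (v , Sv , uv , ¬Λuv) = inj₁ (v , ≡S v Sv , uv , ≡Λ u v ¬Λuv)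
    ... | inj₂ (v , Λuv , ¬Sv)      = inj₂ (v , ≡Λ u v Λuv , ≡S v ¬Sv)

  SubdivisionOfSize : ℕ → Set
  SubdivisionOfSize k = Σ (ArcSet (n D)) λ Λ → D ⊆A Λ × SubdivisionHasKernel D Λ × card Λ ≡ k

  subdivisionOfSize? : ∀ k → Dec (SubdivisionOfSize k)
  subdivisionOfSize? k = map′
    (λ (Λ , Λ⊆A , (S , t) , size) → Λ , Λ⊆A , trace⇒kernel t , size)
    (λ (Λ , Λ⊆A , kernel , size) → Λ , Λ⊆A , kernel⇒trace kernel , size)
    (searchable-ArcSet (n D) P P-resp P?)
    where
    P : ArcSet (n D) → Set
    P Λ = D ⊆A Λ × ∃ (IsKernelTrace Λ) × card Λ ≡ k
    P-resp : P Respects (λ Λ Λ′ → ∀ u → Λ u ≗ Λ′ u)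
    P-resp Λ≗ (Λ⊆A , (S , t) , size) =
      (λ u v Λ′uv → Λ⊆A u v (trans (Λ≗ u v) Λ′uv)) ,
      (S , IsKernelTraceOn-cong Λ≗ (λ _ → refl) t) ,
      trans (sym (card-cong Λ≗)) size
    P? : Decidable P
    P? Λ =  all? (λ u → all? λ v → (Λ u v ≟ᵇ true) →-dec (arc D u v ≟ᵇ true))
      ×-dec searchable-Subset (n D) (IsKernelTrace Λ)
              (IsKernelTraceOn-cong (λ _ _ → refl)) (isKernelTraceOn? Λ (λ _ → true))
      ×-dec card Λ ≟ℕ k

  kappa-below : ∀ Λ → D ⊆A Λ → SubdivisionHasKernel D Λ → ∃ λ k → IsKappa D k × k ≤ card Λ
  kappa-below Λ Λ⊆A kernel with least subdivisionOfSize? (Λ , Λ⊆A , kernel , refl)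
  ... | k , attained , k≤ , below = k , (attained , minimal) , k≤
    where
    minimal : ∀ Λ′ → D ⊆A Λ′ → SubdivisionHasKernel D Λ′ → k ≤ card Λ′
    minimal Λ′ Λ′⊆A kernel′ = ≮⇒≥ λ Λ′<k → below (card Λ′) Λ′<k (Λ′ , Λ′⊆A , kernel′ , refl)

-- Closed walks and chordless cycles

next-spec : ∀ {k} (i : Fin (suc k)) → (toℕ i < k × toℕ (next i) ≡ suc (toℕ i)) ⊎ (toℕ i ≡ k × next i ≡ zero)
next-spec {k} i with suc (toℕ i) <? suc k
... | yes 1+i<1+k = inj₁ (≤-pred 1+i<1+k , toℕ-fromℕ< 1+i<1+k)
... | no  1+i≮1+k = inj₂ (≤-antisym (toℕ≤pred[n] i) (≮⇒≥ λ k<i → 1+i≮1+k (s≤s k<i)) , refl)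

toℕ-positive : ∀ {k} (j : Fin (suc k)) → j ≢ zero → 0 < toℕ j
toℕ-positive zero    j≢0 = contradiction refl j≢0
toℕ-positive (suc j) _   = z<s

suc-% : ∀ t d → suc t % suc d ≡ suc (t % suc d) % suc d
suc-% t d = begin
  (1 + t) % suc d                         ≡⟨ %-distribˡ-+ 1 t (suc d) ⟩
  (1 % suc d + t % suc d) % suc d         ≡⟨ cong (λ r → (1 % suc d + r) % suc d) (sym (m%n%n≡m%n t (suc d))) ⟩
  (1 % suc d + t % suc d % suc d) % suc d ≡⟨ sym (%-distribˡ-+ 1 (t % suc d) (suc d)) ⟩
  (1 + t % suc d) % suc d                 ∎
  where open ≡-Reasoning

CycleWithin : (D : Digraph) → (Fin (n D) → Bool) → ArcSet (n D) → Set
CycleWithin D R C = IsChordlessCycle D C × (∀ u v → C u v ≡ true → R u ≡ true)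

module _ (D : Digraph) (R : Fin (n D) → Bool) where

  private
    V : Set
    V = Fin (n D)

  record Walk : Set where
    field
      vertex : ℕ → V
      inside : ∀ t → R (vertex t) ≡ true
      step   : ∀ t → arc D (vertex t) (vertex (suc t)) ≡ true

  record ClosedWalk : Set where
    field
      walk     : Walk
      k        : ℕ
      periodic : ∀ t → Walk.vertex walk (t + suc k) ≡ Walk.vertex walk t

  open Walk
  open ClosedWalk using (walk; k; periodic)

  drop : ℕ → Walk → Walk
  drop s w = record { vertex = λ t → vertex w (s + t) ; inside = λ t → inside w (s + t) ; step = step′ }
    where
    step′ : ∀ t → arc D (vertex w (s + t)) (vertex w (s + suc t)) ≡ true
    step′ t rewrite +-suc s t = step w (s + t)

  wrap : (w : Walk) (d : ℕ) → arc D (vertex w d) (vertex w 0) ≡ true → ClosedWalk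
  wrap w d closing = record
    { walk     = record { vertex = vertex w ∘ (_% suc d) ; inside = inside w ∘ (_% suc d) ; step = step′ }
    ; k        = d
    ; periodic = λ t → cong (vertex w) ([m+n]%n≡m%n t (suc d))
    }
    where
    step′ : ∀ t → arc D (vertex w (t % suc d)) (vertex w (suc t % suc d)) ≡ true
    step′ t rewrite suc-% t d with m≤n⇒m<n∨m≡n (≤-pred (m%n<n t (suc d)))
    ... | inj₁ r<d rewrite m<n⇒m%n≡m (s≤s r<d) = step w (t % suc d)
    ... | inj₂ r≡d rewrite r≡d | n%n≡0 (suc d) ⦃ _ ⦄ = closing

  cut : (w : Walk) (s d : ℕ) → arc D (vertex w (s + d)) (vertex w s) ≡ true → ClosedWalk
  cut w s d closing =
    wrap (drop s w) d (subst (λ t → arc D (vertex w (s + d)) (vertex w t) ≡ true) (sym (+-identityʳ s)) closing)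

  cut-at-repeat : (w : Walk) {a b : ℕ} → a < b → vertex w a ≡ vertex w b → Σ ClosedWalk λ c → k c < b
  cut-at-repeat w {a} a<b same with m≤n⇒∃[o]m+o≡n a<b
  ... | d , refl =
    cut w a d (subst (λ v → arc D (vertex w (a + d)) v ≡ true) (sym same) (step w (a + d))) , s≤s (m≤n+m d a)

  cut-at-repeat-before : (w : Walk) {a b m : ℕ} → b ≤ m → a < b → vertex w a ≡ vertex w b →
    Σ ClosedWalk λ c → k c < m
  cut-at-repeat-before w b≤m a<b same with cut-at-repeat w a<b same
  ... | c , k<b = c , <-≤-trans k<b b≤m

  module _ (c : ClosedWalk) where
    at : ℕ → V
    at = vertex (walk c)

    cyc : Fin (suc (k c)) → V
    cyc i = at (toℕ i)

    Defect : Fin (suc (k c)) → Fin (suc (k c)) → Set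
    Defect i j = (i ≢ j × cyc i ≡ cyc j) ⊎ (arc D (cyc i) (cyc j) ≡ true × j ≢ next i)

    defect? : Dec (∃₂ Defect)
    defect? = any? λ i → any? λ j →
      (¬? (i ≟ᶠ j) ×-dec (cyc i ≟ᶠ cyc j)) ⊎-dec ((arc D (cyc i) (cyc j) ≟ᵇ true) ×-dec ¬? (j ≟ᶠ next i))

    cut-at-chord : ∀ {s e} d → s + d ≡ e → arc D (at e) (at s) ≡ true → ClosedWalk
    cut-at-chord {s} d s+d≡e chord = cut (walk c) s d (subst (λ e → arc D (at e) (at s) ≡ true) (sym s+d≡e) chord)

    chord-backward : ∀ i j → toℕ j ≤ toℕ i → arc D (cyc i) (cyc j) ≡ true → j ≢ next i →
      Σ ClosedWalk λ c′ → k c′ < k c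
    chord-backward i j j≤i chord j≢next with m≤n⇒∃[o]m+o≡n j≤i
    ... | d , j+d≡i = cut-at-chord d j+d≡i chord , d<k (next-spec i)
      where
      d<k : _ → d < k c
      d<k (inj₁ (i<k , _)) = ≤-<-trans (subst (d ≤_) j+d≡i (m≤n+m d (toℕ j))) i<k
      d<k (inj₂ (i≡k , next≡0)) =
        subst (d <_) (trans j+d≡i i≡k) (m<n+m d (toℕ-positive j λ j≡0 → j≢next (trans j≡0 (sym next≡0))))

    chord-forward : ∀ i j → toℕ i < toℕ j → arc D (cyc i) (cyc j) ≡ true → j ≢ next i →
      Σ ClosedWalk λ c′ → k c′ < k c
    -- By periodicity the chord also leaves index i + (k + 1), which lies beyond j.
    chord-forward i j i<j chord j≢next
      with m≤n⇒∃[o]m+o≡n (≤-trans (toℕ≤pred[n] j) (≤-trans (n≤1+n (k c)) (m≤n+m (suc (k c)) (toℕ i))))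
    ... | d , j+d≡e =
      cut-at-chord d j+d≡e (subst (λ v → arc D v (cyc j) ≡ true) (sym (periodic c (toℕ i))) chord) , d<k (next-spec i)
      where
      d<k : _ → d < k c
      d<k (inj₂ (i≡k , _)) = contradiction (≤-trans i<j (subst (toℕ j ≤_) (sym i≡k) (toℕ≤pred[n] j))) (<-irrefl refl)
      d<k (inj₁ (_ , next≡1+i)) = +-cancelˡ-≤ (toℕ i) (suc d) (k c) (≤-pred (begin
        suc (toℕ i + suc d)     ≡⟨ cong suc (+-suc (toℕ i) d) ⟩
        suc (suc (toℕ i)) + d   ≤⟨ +-monoˡ-≤ d 2+i≤j ⟩
        toℕ j + d               ≡⟨ j+d≡e ⟩
        toℕ i + suc (k c)       ≡⟨ +-suc (toℕ i) (k c) ⟩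
        suc (toℕ i + k c)       ∎))
        where
        open ≤-Reasoning
        2+i≤j : suc (suc (toℕ i)) ≤ toℕ j
        2+i≤j = ≤∧≢⇒< i<j λ 1+i≡j → j≢next (toℕ-injective (trans (sym 1+i≡j) (sym next≡1+i)))

    shorten : ∀ {i j} → Defect i j → Σ ClosedWalk λ c′ → k c′ < k c
    shorten {i} {j} (inj₁ (i≢j , same)) with <-cmp i j
    ... | tri< i<j _ _ = cut-at-repeat-before (walk c) (toℕ≤pred[n] j) i<j same
    ... | tri≈ _ i≡j _ = contradiction i≡j i≢j
    ... | tri> _ _ j<i = cut-at-repeat-before (walk c) (toℕ≤pred[n] i) j<i (sym same)
    shorten {i} {j} (inj₂ (chord , j≢next)) with toℕ j ≤? toℕ i
    ... | yes j≤i = chord-backward i j j≤i chord j≢next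
    ... | no  j≰i = chord-forward i j (≰⇒> j≰i) chord j≢next

    1≤k : 1 ≤ k c
    1≤k = ≤∧≢⇒< z≤n λ 0≡k → bool-clash
      (subst (λ v → arc D (at 0) v ≡ true) (subst (λ m → at (suc m) ≡ at 0) (sym 0≡k) (periodic c 0))
             (step (walk c) 0))
      (loopless D (at 0))

    cyc-next : ∀ i → cyc (next i) ≡ at (suc (toℕ i))
    cyc-next i with next-spec i
    ... | inj₁ (_ , next≡1+i)    = cong at next≡1+i
    ... | inj₂ (i≡k , next≡0) = begin
      cyc (next i)      ≡⟨ cong cyc next≡0 ⟩
      at 0              ≡⟨ sym (periodic c 0) ⟩
      at (suc (k c))    ≡⟨ cong (at ∘ suc) (sym i≡k) ⟩
      at (suc (toℕ i))  ∎
      where open ≡-Reasoning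

    cycle-arcs : ArcSet (n D)
    cycle-arcs u v = does (any? λ i → (cyc i ≟ᶠ u) ×-dec (cyc (next i) ≟ᶠ v))

    cycle-within : ¬ ∃₂ Defect → CycleWithin D R cycle-arcs
    cycle-within no-defect = (k c , cyc , 1≤k , injective , step-next , along , on-cycle , chordless) , inside′
      where
      injective : ∀ {i j} → cyc i ≡ cyc j → i ≡ j
      injective {i} {j} same with i ≟ᶠ j
      ... | yes i≡j = i≡j
      ... | no  i≢j = contradiction (i , j , inj₁ (i≢j , same)) no-defect
      step-next : ∀ i → arc D (cyc i) (cyc (next i)) ≡ true
      step-next i = subst (λ v → arc D (cyc i) v ≡ true) (sym (cyc-next i)) (step (walk c) (toℕ i))
      along : ∀ u v → cycle-arcs u v ≡ true → Σ (Fin (suc (k c))) λ i → cyc i ≡ u × cyc (next i) ≡ v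
      along u v = does⇒ (any? λ i → (cyc i ≟ᶠ u) ×-dec (cyc (next i) ≟ᶠ v))
      on-cycle : ∀ i → cycle-arcs (cyc i) (cyc (next i)) ≡ true
      on-cycle i = dec-true (any? λ i′ → (cyc i′ ≟ᶠ cyc i) ×-dec (cyc (next i′) ≟ᶠ cyc (next i))) (i , refl , refl)
      chordless : ∀ i j → arc D (cyc i) (cyc j) ≡ true → cycle-arcs (cyc i) (cyc j) ≡ true
      chordless i j chord with j ≟ᶠ next i
      ... | yes refl    = on-cycle i
      ... | no  j≢next = contradiction (i , j , inj₂ (chord , j≢next)) no-defect
      inside′ : ∀ u v → cycle-arcs u v ≡ true → R u ≡ true
      inside′ u v uv with along u v uv
      ... | i , refl , _ = inside (walk c) (toℕ i)

  chordless-cycle : ClosedWalk → Σ (ArcSet (n D)) (CycleWithin D R)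
  chordless-cycle c = go c (<-wellFounded (k c))
    where
    go : (c : ClosedWalk) → Acc _<_ (k c) → Σ (ArcSet (n D)) (CycleWithin D R)
    go c (acc smaller) with defect? c
    ... | no  no-defect       = cycle-arcs c , cycle-within c no-defect
    ... | yes (_ , _ , defect) with shorten c defect
    ...   | c′ , k′<k = go c′ (smaller k′<k)

  Sinkless : Set
  Sinkless = ∀ u → R u ≡ true → Σ V λ v → R v ≡ true × arc D u v ≡ true

  sinkless-walk : ∀ u → R u ≡ true → Sinkless → Walk
  sinkless-walk u₀ Ru₀ sinkless = record
    { vertex = proj₁ ∘ position
    ; inside = proj₂ ∘ position
    ; step   = λ t → proj₂ (proj₂ (sinkless (proj₁ (position t)) (proj₂ (position t))))
    }
    where
    position : ℕ → Σ V λ u → R u ≡ true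
    position zero    = u₀ , Ru₀
    position (suc t) = let (v , Rv , _) = sinkless (proj₁ (position t)) (proj₂ (position t)) in v , Rv

  sinkless⇒chordless-cycle : ∀ u → R u ≡ true → Sinkless → Σ (ArcSet (n D)) (CycleWithin D R)
  sinkless⇒chordless-cycle u Ru sinkless = closed (pigeonhole (n<1+n (n D)) (vertex w ∘ toℕ))
    where
    w : Walk
    w = sinkless-walk u Ru sinkless
    closed : ∃₂ (λ i j → toℕ i < toℕ j × vertex w (toℕ i) ≡ vertex w (toℕ j)) →
      Σ (ArcSet (n D)) (CycleWithin D R)
    closed (_ , _ , i<j , same) = chordless-cycle (proj₁ (cut-at-repeat w i<j same))

-- Building the kernel

cycle-arc : ∀ {D C} → IsChordlessCycle D C →
  Σ (Fin (n D)) λ x → Σ (Fin (n D)) λ y → C x y ≡ true × arc D x y ≡ true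
cycle-arc (_ , f , _ , _ , steps , _ , on-cycle , _) = f zero , f (next zero) , on-cycle zero , steps zero

module _ (D : Digraph) where

  private
    V : Set
    V = Fin (n D)

  record PartialKernel (R : V → Bool) : Set where
    field
      Λ        : ArcSet (n D)
      S        : V → Bool
      Λ-inside : ∀ u v → Λ u v ≡ true → R u ≡ true × arc D u v ≡ true
      S-inside : ∀ u → S u ≡ true → R u ≡ true
      trace    : IsKernelTraceOn D Λ R S
    open IsKernelTraceOn trace public

  module PK = PartialKernel

  empty-kernel : ∀ {R} → (∀ u → R u ≡ false) → PartialKernel R
  empty-kernel nothing = record
    { Λ = λ _ _ → false ; S = λ _ → false
    ; Λ-inside = λ _ _ () ; S-inside = λ _ ()
    ; trace = record
      { subdivided-inside = λ _ _ ()
      ; subdivided-out    = λ _ _ ()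
      ; absorbed          = λ u Ru _ → ⊥-elim (bool-clash Ru (nothing u))
      }
    }

  Sink : (V → Bool) → V → Set
  Sink R x = R x ≡ true × (∀ y → R y ≡ true → arc D x y ≡ false)

  sink? : ∀ R → Decidable (Sink R)
  sink? R x = (R x ≟ᵇ true) ×-dec all? (λ y → (R y ≟ᵇ true) →-dec (arc D x y ≟ᵇ false))

  ClosedInNeighbour : V → V → Set
  ClosedInNeighbour x u = u ≡ x ⊎ arc D u x ≡ true

  closedInNeighbour? : ∀ x → Decidable (ClosedInNeighbour x)
  closedInNeighbour? x u = (u ≟ᶠ x) ⊎-dec (arc D u x ≟ᵇ true)

  add-sink : ∀ {R x} → Sink R x →
    (K : PartialKernel (remove (closedInNeighbour? x) R)) → Σ (PartialKernel R) λ K′ → PK.Λ K′ ≡ PK.Λ K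
  add-sink {R} {x} (Rx , sink) K = record
    { Λ = Λ ; S = insert x S
    ; Λ-inside = λ u v Λuv → let (R′u , uv) = Λ-inside u v Λuv in remove-⊆ R′u , uv
    ; S-inside = S′-inside
    ; trace = record
      { subdivided-inside = inside′
      ; subdivided-out    = out′
      ; absorbed          = absorbed′
      }
    } , refl
    where
    open PartialKernel K
    open Remove (closedInNeighbour? x) R
    open Insert x S
    S′-inside : ∀ u → insert x S u ≡ true → R u ≡ true
    S′-inside u S′u with insert-elim {u} S′u
    ... | inj₁ refl = Rx
    ... | inj₂ Su   = remove-⊆ (S-inside u Su)
    inside′ : ∀ u v → insert x S u ≡ true → insert x S v ≡ true → arc D u v ≡ true → Λ u v ≡ true
    inside′ u v S′u S′v uv with insert-elim {u} S′u | insert-elim {v} S′v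
    ... | inj₁ refl | inj₁ refl = ⊥-elim (bool-clash uv (loopless D x))
    ... | inj₁ refl | inj₂ Sv   = ⊥-elim (bool-clash uv (sink v (remove-⊆ (S-inside v Sv))))
    ... | inj₂ Su   | inj₁ refl = contradiction (inj₂ uv) (remove-∉ (S-inside u Su))
    ... | inj₂ Su   | inj₂ Sv   = subdivided-inside u v Su Sv uv
    out′ : ∀ u v → Λ u v ≡ true → insert x S u ≡ true → insert x S v ≡ true
    out′ u v Λuv S′u with insert-elim {u} S′u
    ... | inj₁ refl = contradiction (inj₁ refl) (remove-∉ (proj₁ (Λ-inside x v Λuv)))
    ... | inj₂ Su   = insert-old (subdivided-out u v Λuv Su)
    absorbed′ : ∀ u → R u ≡ true → insert x S u ≡ false → Absorbed D Λ (insert x S) u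
    absorbed′ u Ru ¬S′u with closedInNeighbour? x u
    ... | yes (inj₁ refl) = ⊥-elim (bool-clash insert-new ¬S′u)
    ... | yes (inj₂ ux)   = inj₁ (x , insert-new , ux , ¬-not λ Λux → remove-∉ (proj₁ (Λ-inside u x Λux)) (inj₂ ux))
    ... | no ¬dominated
        with absorbed u (remove-∋ Ru ¬dominated) (trans (sym (insert-other (¬dominated ∘ inj₁))) ¬S′u)
    ...   | inj₁ (v , Sv , uv , ¬Λuv) = inj₁ (v , insert-old Sv , uv , ¬Λuv)
    ...   | inj₂ (v , Λuv , ¬Sv)      = inj₂ (v , Λuv , trans (insert-other v≢x) ¬Sv)
      where
      v≢x : v ≢ x
      v≢x refl = ¬dominated (inj₂ (proj₂ (Λ-inside u x Λuv)))

  module _ {R : V → Bool} {x y : V} (Rx : R x ≡ true) (xy : arc D x y ≡ true)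
           (K : PartialKernel (remove (_≟ᶠ x) R)) where
    open PartialKernel K
    open Remove (_≟ᶠ x) R

    absorb-by-head : S y ≡ true → Σ (PartialKernel R) λ K′ → PK.Λ K′ ≡ PK.Λ K
    absorb-by-head Sy = record
      { Λ = Λ ; S = S
      ; Λ-inside = λ u v Λuv → let (R′u , uv) = Λ-inside u v Λuv in remove-⊆ R′u , uv
      ; S-inside = λ u Su → remove-⊆ (S-inside u Su)
      ; trace = record
        { subdivided-inside = subdivided-inside
        ; subdivided-out    = subdivided-out
        ; absorbed          = absorbed′
        }
      } , refl
      where
      absorbed′ : ∀ u → R u ≡ true → S u ≡ false → Absorbed D Λ S u
      absorbed′ u Ru ¬Su with u ≟ᶠ x
      ... | yes refl = inj₁ (y , Sy , xy , ¬-not λ Λxy → remove-∉ (proj₁ (Λ-inside x y Λxy)) refl)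
      ... | no  u≢x  = absorbed u (remove-∋ Ru u≢x) ¬Su

    subdivide-to-head : S y ≡ false → Σ (PartialKernel R) λ K′ → PK.Λ K′ ≡ insertArc x y Λ
    subdivide-to-head ¬Sy = record
      { Λ = insertArc x y Λ ; S = S
      ; Λ-inside = Λ′-inside
      ; S-inside = λ u Su → remove-⊆ (S-inside u Su)
      ; trace = record
        { subdivided-inside = λ u v Su Sv uv → insertArc-old (subdivided-inside u v Su Sv uv)
        ; subdivided-out    = out′
        ; absorbed          = absorbed′
        }
      } , refl
      where
      open InsertArc x y Λ
      Λ′-inside : ∀ u v → insertArc x y Λ u v ≡ true → R u ≡ true × arc D u v ≡ true
      Λ′-inside u v Λ′uv with insertArc-elim {u} {v} Λ′uv
      ... | inj₁ (refl , refl) = Rx , xy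
      ... | inj₂ Λuv           = let (R′u , uv) = Λ-inside u v Λuv in remove-⊆ R′u , uv
      out′ : ∀ u v → insertArc x y Λ u v ≡ true → S u ≡ true → S v ≡ true
      out′ u v Λ′uv Su with insertArc-elim {u} {v} Λ′uv
      ... | inj₁ (refl , _) = contradiction refl (remove-∉ (S-inside x Su))
      ... | inj₂ Λuv        = subdivided-out u v Λuv Su
      absorbed′ : ∀ u → R u ≡ true → S u ≡ false → Absorbed D (insertArc x y Λ) S u
      absorbed′ u Ru ¬Su = by-cases (u ≟ᶠ x)
        where
        by-cases : Dec (u ≡ x) → Absorbed D (insertArc x y Λ) S u
        by-cases (yes refl) = inj₂ (y , insertArc-new , ¬Sy)
        by-cases (no  u≢x) with absorbed u (remove-∋ Ru u≢x) ¬Su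
        ... | inj₁ (v , Sv , uv , ¬Λuv) = inj₁ (v , Sv , uv , trans (insertArc-other u≢x v) ¬Λuv)
        ... | inj₂ (v , Λuv , ¬Sv)      = inj₂ (v , insertArc-old Λuv , ¬Sv)

    add-arc-tail : Σ (PartialKernel R) λ K′ → card (PK.Λ K′) ≤ suc (card Λ)
    add-arc-tail with S y in Sy
    ... | true  = let (K′ , same) = absorb-by-head Sy in K′ , ≤-trans (≤-reflexive (cong card same)) (n≤1+n _)
    ... | false = let (K′ , same) = subdivide-to-head Sy in
                  K′ , ≤-trans (≤-reflexive (cong card same)) (InsertArc.card-insertArc x y Λ)

  record PartialSolution (R : V → Bool) : Set where
    field
      kernel          : PartialKernel R
      cycles          : List (ArcSet (n D))
      cycles-within   : All (CycleWithin D R) cycles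
      cycles-distinct : AllPairs (λ C C′ → ¬ C ≐ C′) cycles
      card≤cycles     : card (PK.Λ kernel) ≤ length cycles

  weaken-cycles : ∀ {R R′} → (∀ {u} → R′ u ≡ true → R u ≡ true) →
    ∀ {Cs} → All (CycleWithin D R′) Cs → All (CycleWithin D R) Cs
  weaken-cycles R′⊆R = All.map λ (isC , inside) → isC , λ u v Cuv → R′⊆R (inside u v Cuv)

  empty-solution : ∀ {R} → (∀ u → R u ≡ false) → PartialSolution R
  empty-solution nothing = record
    { kernel = empty-kernel nothing ; cycles = [] ; cycles-within = [] ; cycles-distinct = []
    ; card≤cycles = ≤-reflexive (trans (sumFin-cong {n D} λ _ → sumFin-zero {n D}) (sumFin-zero {n D}))
    }

  sink-solution : ∀ {R x} → Sink R x → PartialSolution (remove (closedInNeighbour? x) R) → PartialSolution R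
  sink-solution {R} {x} x-sink sol = record
    { kernel = proj₁ extended ; cycles = cycles
    ; cycles-within = weaken-cycles (Remove.remove-⊆ (closedInNeighbour? x) R) cycles-within
    ; cycles-distinct = cycles-distinct
    ; card≤cycles = subst (λ Λ → card Λ ≤ length cycles) (sym (proj₂ extended)) card≤cycles
    }
    where
    open PartialSolution sol
    extended : Σ (PartialKernel R) λ K → PK.Λ K ≡ PK.Λ kernel
    extended = add-sink x-sink kernel

  cycle-solution : ∀ {R C x y} → CycleWithin D R C → C x y ≡ true → arc D x y ≡ true →
    PartialSolution (remove (_≟ᶠ x) R) → PartialSolution R
  cycle-solution {R} {C} {x} {y} within Cxy xy sol = record
    { kernel = proj₁ extended ; cycles = C ∷ cycles
    ; cycles-within = within ∷ weaken-cycles remove-⊆ cycles-within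
    ; cycles-distinct = All.map (λ (_ , inside) C≐C′ → remove-∉ (inside x y (trans (sym (C≐C′ x y)) Cxy)) refl)
                                cycles-within
                        ∷ cycles-distinct
    ; card≤cycles = ≤-trans (proj₂ extended) (s≤s card≤cycles)
    }
    where
    open PartialSolution sol
    open Remove (_≟ᶠ x) R
    extended : Σ (PartialKernel R) λ K → card (PK.Λ K) ≤ suc (card (PK.Λ kernel))
    extended = add-arc-tail (proj₂ within x y Cxy) xy kernel

  no-sink⇒sinkless : ∀ {R} → ¬ ∃ (Sink R) → Sinkless D R
  no-sink⇒sinkless {R} no-sink u Ru with any? (λ v → (R v ≟ᵇ true) ×-dec (arc D u v ≟ᵇ true))
  ... | yes found = found
  ... | no  none  = contradiction (u , Ru , λ v Rv → ¬-not λ uv → none (v , Rv , uv)) no-sink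

  extend : ∀ R → (∀ {P : V → Set} (P? : Decidable P) {x} → R x ≡ true → P x → PartialSolution (remove P? R)) →
    PartialSolution R
  extend R solve-without with any? (λ u → R u ≟ᵇ true) | any? (sink? R)
  ... | no  empty    | _                = empty-solution λ u → ¬-not λ Ru → empty (u , Ru)
  ... | yes _        | yes (x , x-sink) = sink-solution x-sink (solve-without (closedInNeighbour? x) (proj₁ x-sink) (inj₁ refl))
  ... | yes (u , Ru) | no  no-sink      = through (sinkless⇒chordless-cycle D R u Ru (no-sink⇒sinkless no-sink))
    where
    through : Σ (ArcSet (n D)) (CycleWithin D R) → PartialSolution R
    through (C , within) with cycle-arc {D} {C} (proj₁ within)
    ... | x , y , Cxy , xy = cycle-solution within Cxy xy (solve-without (_≟ᶠ x) (proj₂ within x y Cxy) refl)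

  solve : ∀ R → PartialSolution R
  solve R = go R (<-wellFounded (count R))
    where
    go : ∀ R → Acc _<_ (count R) → PartialSolution R
    go R (acc smaller) = extend R λ P? Rx Px → go (remove P? R) (smaller (Remove.count-remove P? R Rx Px))

  kernel-subdivision-≤-cic : ∀ c → IsCic D c →
    Σ (ArcSet (n D)) λ Λ → D ⊆A Λ × SubdivisionHasKernel D Λ × card Λ ≤ c
  kernel-subdivision-≤-cic c (all-cycles , _ , _ , covering , length≡c) = from (solve (λ _ → true))
    where
    from : PartialSolution (λ _ → true) →
      Σ (ArcSet (n D)) λ Λ → D ⊆A Λ × SubdivisionHasKernel D Λ × card Λ ≤ c
    from sol = Λ , (λ u v → proj₂ ∘ Λ-inside u v) , trace⇒kernel D trace ,
      ≤-trans card≤cycles (subst (length cycles ≤_) length≡c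
        (length-≤-of-covered (≐-setoid (n D)) cycles all-cycles cycles-distinct
          (All.map (λ within → covering _ (proj₁ within)) cycles-within)))
      where
      open PartialSolution sol
      open PartialKernel kernel

mainTheorem1 : (D : Digraph) (c : ℕ) → IsCic D c →
    Σ ℕ (λ k → IsKappa D k × 0 ≤ k × k ≤ c)
mainTheorem1 D c cic with kernel-subdivision-≤-cic D c cic
... | Λ , Λ⊆A , kernel , card≤c with kappa-below D Λ Λ⊆A kernel
...   | k , isKappa , k≤card = k , isKappa , z≤n , ≤-trans k≤card card≤c
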